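{- Let $\mathcal F$ be a Fano plane and $n\in V_{\mathcal F}^\ast$. Then $\mathcal F_n$ is an affine space for $\mathcal S^2_0(V_{\mathcal F}^\ast)$, i.e. for every $\alpha\in\mathcal F_n$ and $\Delta\in\mathcal S^2_0(V_{\mathcal F}^\ast)$ the map $P\mapsto\alpha_P+\Delta(P,\cdot)$ lies in $\mathcal F_n$, and for any $\alpha,\beta\in\mathcal F_n$ there is a unique $\Delta\in\mathcal S^2_0(V_{\mathcal F}^\ast)$ with $\beta_P=\alpha_P+\Delta(P,\cdot)$ for all $P\in\mathcal F$. In particular $\mathcal F_0$ has exactly $8$ elements.
   Context: A Fano plane is a set $\mathcal F$ of seven points together with a set of seven $3$-element subsets of $\mathcal F$ called lines, such that any two distinct points lie in a unique line and any two distinct lines meet in a unique point. The Fano cube is $V_{\mathcal F}=\mathcal F\cup\{0\}$ with the unique $\mathbb Z_2$-vector space structure with zero $0$ such that for distinct $P,Q\in\mathcal F$, $P+Q$ is the third point of the line through $P$ and $Q$; $V_{\mathcal F}^\ast$ is its dual. For $n\in V_{\mathcal F}^\ast$, an $n$-oriented map is a map $\alpha:\mathcal F\to V_{\mathcal F}^\ast$, $P\mapsto\alpha_P$, such that (i) $\alpha_P(P)+n(P)=1$ for all $P\in\mathcal F$, and (ii) $\alpha_P(Q)+\alpha_Q(P)=1$ for all $P\neq Q$ in $\mathcal F$; $\mathcal F_n$ is the set of $n$-oriented maps. $\mathcal S^2_0(V_{\mathcal F}^\ast)$ is the $\mathbb Z_2$-vector space of symmetric bilinear forms $B$ on $V_{\mathcal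 F}$ with $B(P,P)=0$ for all $P\in\mathcal F$. -}

module Defs where

open import Data.Nat using (ℕ)
open import Data.Fin using (Fin)
open import Data.Fin.Subset using (Subset; _∈_; ∣_∣)
open import Data.Bool using (Bool; true; false; _xor_)
open import Data.Product using (Σ; ∃; ∃!; _×_)
open import Relation.Binary.PropositionalEquality using (_≡_; _≢_)

record FanoPlane : Set where
  field
    line      : Fin 7 → Subset 7
    line-size : ∀ i → ∣ line i ∣ ≡ 3
    line-inj  : ∀ i j → line i ≡ line j → i ≡ j
    two-points : ∀ (P Q : Fin 7) → P ≢ Q →
                 ∃! _≡_ (λ i → (P ∈ line i) × (Q ∈ line i))
    two-lines  : ∀ (i j : Fin 7) → i ≢ j →
                 ∃! _≡_ (λ P → (P ∈ line i) × (P ∈ line j))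

open FanoPlane public

PtFun : Set
PtFun = Fin 7 → Bool

-- f is (the restriction to 𝓕 of) an element of V_𝓕^*: a linear functional on
-- the Fano cube, i.e. f(P+Q) = f(P) + f(Q), where for distinct P,Q, P+Q is the
-- third point R of the line through P and Q (and f(0)=0).
IsDual : FanoPlane → PtFun → Set
IsDual F f = ∀ (i : Fin 7) (P Q R : Fin 7) →
  P ∈ line F i → Q ∈ line F i → R ∈ line F i →
  P ≢ Q → Q ≢ R → P ≢ R →
  f R ≡ f P xor f Q

-- A bilinear form on V_𝓕, given by its values on 𝓕 × 𝓕.
BForm : Set
BForm = Fin 7 → Fin 7 → Bool

IsS20 : FanoPlane → BForm → Set
IsS20 F Δ = (∀ P → IsDual F (Δ P))
          × (∀ P Q → Δ P Q ≡ Δ Q P)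
          × (∀ P → Δ P P ≡ false)

-- A map α : 𝓕 → V_𝓕^*, P ↦ α_P, with α P Q = α_P(Q).
OMap : Set
OMap = Fin 7 → Fin 7 → Bool

IsOriented : FanoPlane → PtFun → OMap → Set
IsOriented F n α = (∀ P → IsDual F (α P))
                 × (∀ P → α P P xor n P ≡ true)
                 × (∀ P Q → P ≢ Q → α P Q xor α Q P ≡ true)

_⊕_ : OMap → BForm → OMap
(α ⊕ Δ) P Q = α P Q xor Δ P Q

_≗₂_ : (Fin 7 → Fin 7 → Bool) → (Fin 7 → Fin 7 → Bool) → Set
f ≗₂ g = ∀ P Q → f P Q ≡ g P Q

zeroDual : PtFun
zeroDual _ = false

module Submission where

-- Pointwise, α ⊕ Δ and α ⊖ β are xors of functionals, and in the orientation conditions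
-- the terms n(P) on the diagonal and the constant 1 in α_P(Q) + α_Q(P) cancel in pairs: so
-- ⊕ preserves n-orientation, and α ⊖ β is the unique form in 𝒮²₀ carrying α to β.
--
-- Counting 𝓕₀ therefore amounts to one 0-oriented map and |𝒮²₀| = 8. Both are read off
-- the standard plane PG(2, 𝔽₂), where duals are linear functionals and 𝒮²₀ consists of
-- the alternating forms on 𝔽₂³, fixed by three Gram entries. An isomorphism ι onto 𝓕
-- sends the unit vectors to a triangle a, b, d and sums of vectors to third points of
-- lines. It respects all seven lines because the third-point operation ⊞ is associative
-- on triangles: the lines through P, Q ⊞ R and through P ⊞ Q, R meet in a point that is
-- neither of the named points on either line, hence is the third point on both.

open import Defs
open import Data.Fin using (Fin)
open import Data.Product using (Σ; ∃; _×_)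
open import Relation.Binary.PropositionalEquality using (_≡_)

open import Algebra.Bundles using (CommutativeRing)
open import Data.Bool using (Bool; true; false; _xor_)
open import Data.Bool.Properties using (xor-∧-commutativeRing; xor-same; xor-assoc; xor-identityʳ)
  renaming (_≟_ to _≟ᴮ_)
open import Data.Empty using (⊥; ⊥-elim)
open import Data.Fin using (zero; suc)
open import Data.Fin.Patterns using (0F; 1F; 2F; 3F; 4F; 5F; 6F; 7F)
open import Data.Fin.Properties using (_≟_; all?; any?; <⇒notInjective)
open import Data.Fin.Subset using (Subset; _∈_; _∉_; ∣_∣; _-_; inside; outside; Nonempty)
open import Data.Fin.Subset.Properties
  using (_∈?_; x∈p⇒∣p-x∣<∣p∣; x∈p∧x≢y⇒x∈p-y; p─⊥≡p; p─q⊆p; nonempty?; Empty-unique; ∣⊥∣≡0)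
open import Data.Nat using (ℕ; suc; _≤_; z≤n; s≤s; s≤s⁻¹)
open import Data.Nat.Properties using (≤-trans; n≤1+n; ≤-reflexive; n<1+n)
open import Data.Product using (_,_; proj₁; proj₂)
open import Data.Product.Properties using (≡-dec)
open import Data.Vec using (_∷_; there)
open import Function using (_∘_)
open import Function.Definitions using (Injective)
open import Relation.Binary.PropositionalEquality
  using (_≢_; refl; sym; trans; subst; subst₂; cong; cong₂; ≢-sym; module ≡-Reasoning)
open import Relation.Nullary using (Dec; yes; no; ¬_; contradiction)
open import Relation.Nullary.Decidable using (toWitness; decidable-stable; _×-dec_; _→-dec_; ¬?)
open import Relation.Unary using (Decidable)
open import Algebra.Properties.CommutativeSemigroup
  (CommutativeRing.+-commutativeSemigroup xor-∧-commutativeRing) using (interchange)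

xor-cancelˡ : ∀ a b → a xor (a xor b) ≡ b
xor-cancelˡ a b = trans (sym (xor-assoc a a b)) (cong (_xor b) (xor-same a))

xor≡false⇒≡ : ∀ {a b} → a xor b ≡ false → a ≡ b
xor≡false⇒≡ {false} refl = refl
xor≡false⇒≡ {true} {true} _ = refl

xor-transpose : ∀ {a b} c → a ≡ c xor b → c xor a ≡ b
xor-transpose {b = b} c refl = xor-cancelˡ c b

_⊖_ : OMap → OMap → BForm
(α ⊖ β) P Q = α P Q xor β P Q

module _ (F : FanoPlane) where

  isDual-xor : ∀ {φ ψ} → IsDual F φ → IsDual F ψ → IsDual F (λ P → φ P xor ψ P)
  isDual-xor {φ} {ψ} φ-dual ψ-dual i P Q R P∈ Q∈ R∈ P≢Q Q≢R P≢R =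
    trans (cong₂ _xor_ (φ-dual i P Q R P∈ Q∈ R∈ P≢Q Q≢R P≢R) (ψ-dual i P Q R P∈ Q∈ R∈ P≢Q Q≢R P≢R))
          (interchange (φ P) (φ Q) (ψ P) (ψ Q))

  ⊕-isOriented : ∀ {n α Δ} → IsOriented F n α → IsS20 F Δ → IsOriented F n (α ⊕ Δ)
  ⊕-isOriented {n} {α} {Δ} (α-dual , α-diag , α-anti) (Δ-dual , Δ-sym , Δ-diag) =
    (λ P → isDual-xor (α-dual P) (Δ-dual P)) , diag , anti
    where
    open ≡-Reasoning
    diag : ∀ P → (α P P xor Δ P P) xor n P ≡ true
    diag P = begin
      (α P P xor Δ P P) xor n P ≡⟨ cong (λ d → (α P P xor d) xor n P) (Δ-diag P) ⟩
      (α P P xor false) xor n P ≡⟨ cong (_xor n P) (xor-identityʳ (α P P)) ⟩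
      α P P xor n P             ≡⟨ α-diag P ⟩
      true                      ∎
    anti : ∀ P Q → P ≢ Q → (α P Q xor Δ P Q) xor (α Q P xor Δ Q P) ≡ true
    anti P Q P≢Q = begin
      (α P Q xor Δ P Q) xor (α Q P xor Δ Q P) ≡⟨ interchange (α P Q) (Δ P Q) (α Q P) (Δ Q P) ⟩
      (α P Q xor α Q P) xor (Δ P Q xor Δ Q P) ≡⟨ cong₂ _xor_ (α-anti P Q P≢Q) (cong (Δ P Q xor_) (sym (Δ-sym P Q))) ⟩
      true xor (Δ P Q xor Δ P Q)              ≡⟨ cong (true xor_) (xor-same (Δ P Q)) ⟩
      true                                    ∎

  ⊖-isS20 : ∀ {n α β} → IsOriented F n α → IsOriented F n β → IsS20 F (α ⊖ β)
  ⊖-isS20 {n} {α} {β} (α-dual , α-diag , α-anti) (β-dual , β-diag , β-anti) =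
    (λ P → isDual-xor (α-dual P) (β-dual P)) , symmetric , diagonal
    where
    open ≡-Reasoning
    symmetric : ∀ P Q → (α ⊖ β) P Q ≡ (α ⊖ β) Q P
    symmetric P Q with P ≟ Q
    ... | yes refl = refl
    ... | no P≢Q = xor≡false⇒≡ (begin
      (α P Q xor β P Q) xor (α Q P xor β Q P) ≡⟨ interchange (α P Q) (β P Q) (α Q P) (β Q P) ⟩
      (α P Q xor α Q P) xor (β P Q xor β Q P) ≡⟨ cong₂ _xor_ (α-anti P Q P≢Q) (β-anti P Q P≢Q) ⟩
      false                                   ∎)
    diagonal : ∀ P → (α ⊖ β) P P ≡ false
    diagonal P = begin
      α P P xor β P P                         ≡⟨ sym (xor-identityʳ _) ⟩
      (α P P xor β P P) xor false             ≡⟨ cong ((α P P xor β P P) xor_) (sym (xor-same (n P))) ⟩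
      (α P P xor β P P) xor (n P xor n P)     ≡⟨ interchange (α P P) (β P P) (n P) (n P) ⟩
      (α P P xor n P) xor (β P P xor n P)     ≡⟨ cong₂ _xor_ (α-diag P) (β-diag P) ⟩
      false                                   ∎

⊕-⊖ : ∀ α β → β ≗₂ (α ⊕ (α ⊖ β))
⊕-⊖ α β P Q = sym (xor-cancelˡ (α P Q) (β P Q))

⊖-unique : ∀ {α β Δ} → β ≗₂ (α ⊕ Δ) → (α ⊖ β) ≗₂ Δ
⊖-unique {α} β≗α⊕Δ P Q = xor-transpose (α P Q) (β≗α⊕Δ P Q)

⊕-injectiveʳ : ∀ {α Δ Δ′} → (α ⊕ Δ) ≗₂ (α ⊕ Δ′) → Δ ≗₂ Δ′
⊕-injectiveʳ {α} {Δ} same P Q = trans (sym (xor-cancelˡ (α P Q) (Δ P Q))) (xor-transpose (α P Q) (same P Q))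

module _ where

  private
    variable
      n : ℕ
      p : Subset n
      x y z w : Fin n

  ∣p∣≤1+∣p-x∣ : ∀ (p : Subset n) x → ∣ p ∣ ≤ suc ∣ p - x ∣
  ∣p∣≤1+∣p-x∣ (inside ∷ p) zero = s≤s (≤-reflexive (cong ∣_∣ (sym (p─⊥≡p p))))
  ∣p∣≤1+∣p-x∣ (outside ∷ p) zero = ≤-trans (≤-reflexive (cong ∣_∣ (sym (p─⊥≡p p)))) (n≤1+n _)
  ∣p∣≤1+∣p-x∣ (inside ∷ p) (suc x) = s≤s (∣p∣≤1+∣p-x∣ p x)
  ∣p∣≤1+∣p-x∣ (outside ∷ p) (suc x) = ∣p∣≤1+∣p-x∣ p x

  x∉p-x : ∀ (p : Subset n) x → x ∉ p - x
  x∉p-x (s ∷ p) zero ()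
  x∉p-x (s ∷ p) (suc x) (there x∈p-x) = x∉p-x p x x∈p-x

  x∈p-y⇒x≢y : x ∈ p - y → x ≢ y
  x∈p-y⇒x≢y {p = p} {y = y} x∈p-y refl = x∉p-x p y x∈p-y

  1≤∣p∣⇒nonempty : 1 ≤ ∣ p ∣ → Nonempty p
  1≤∣p∣⇒nonempty {n} {p} 1≤∣p∣ with nonempty? p
  ... | yes p≢∅ = p≢∅
  ... | no p≡∅ = contradiction (subst (1 ≤_) ∣p∣≡0 1≤∣p∣) λ ()
    where
    ∣p∣≡0 : ∣ p ∣ ≡ 0
    ∣p∣≡0 = trans (cong ∣_∣ (Empty-unique p≡∅)) (∣⊥∣≡0 n)

  third-member : 3 ≤ ∣ p ∣ → ∀ x y → ∃ λ z → z ∈ p × z ≢ x × z ≢ y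
  third-member {p = p} 3≤∣p∣ x y =
    let z , z∈p-x-y = 1≤∣p∣⇒nonempty 1≤∣p-x-y∣
        z∈p-x = p─q⊆p (p - x) _ z∈p-x-y
    in z , p─q⊆p p _ z∈p-x , x∈p-y⇒x≢y z∈p-x , x∈p-y⇒x≢y z∈p-x-y
    where
    1≤∣p-x-y∣ : 1 ≤ ∣ p - x - y ∣
    1≤∣p-x-y∣ = s≤s⁻¹ (s≤s⁻¹ (≤-trans 3≤∣p∣ (≤-trans (∣p∣≤1+∣p-x∣ p x) (s≤s (∣p∣≤1+∣p-x∣ (p - x) y)))))

  four-members⇒4≤∣p∣ : x ∈ p → y ∈ p → z ∈ p → w ∈ p →
                       x ≢ y → x ≢ z → x ≢ w → y ≢ z → y ≢ w → z ≢ w → 4 ≤ ∣ p ∣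
  four-members⇒4≤∣p∣ {x = x} {p = p} {y} {z} {w} x∈p y∈p z∈p w∈p x≢y x≢z x≢w y≢z y≢w z≢w =
    ≤-trans (s≤s (≤-trans (s≤s (≤-trans (s≤s 1≤∣p-x-y-z∣) (x∈p⇒∣p-x∣<∣p∣ z∈p-x-y))) (x∈p⇒∣p-x∣<∣p∣ y∈p-x)))
            (x∈p⇒∣p-x∣<∣p∣ x∈p)
    where
    y∈p-x = x∈p∧x≢y⇒x∈p-y y∈p (≢-sym x≢y)
    z∈p-x-y = x∈p∧x≢y⇒x∈p-y (x∈p∧x≢y⇒x∈p-y z∈p (≢-sym x≢z)) (≢-sym y≢z)
    w∈p-x-y-z = x∈p∧x≢y⇒x∈p-y (x∈p∧x≢y⇒x∈p-y (x∈p∧x≢y⇒x∈p-y w∈p (≢-sym x≢w)) (≢-sym y≢w)) (≢-sym z≢w)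
    1≤∣p-x-y-z∣ : 1 ≤ ∣ p - x - y - z ∣
    1≤∣p-x-y-z∣ = ≤-trans (s≤s z≤n) (x∈p⇒∣p-x∣<∣p∣ w∈p-x-y-z)

injective⇒surjective : ∀ {n} (f : Fin n → Fin n) → Injective _≡_ _≡_ f → ∀ y → ∃ λ x → f x ≡ y
injective⇒surjective {n} f f-injective y with any? (λ x → f x ≟ y)
... | yes hit = hit
... | no miss = ⊥-elim (<⇒notInjective (n<1+n n) g-injective)
  where
  g : Fin (suc n) → Fin n
  g zero = y
  g (suc x) = f x
  g-injective : Injective _≡_ _≡_ g
  g-injective {zero}  {zero}   _     = refl
  g-injective {zero}  {suc x}  y≡fx  = contradiction (x , sym y≡fx) miss
  g-injective {suc x} {zero}   fx≡y  = contradiction (x , fx≡y) miss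
  g-injective {suc x} {suc x′} fx≡fx′ = cong suc (f-injective fx≡fx′)

module Geometry (F : FanoPlane) where

  private
    variable
      P Q R S : Fin 7
      i j : Fin 7
      Y : Fin 7

  Collinear : Fin 7 → Fin 7 → Fin 7 → Set
  Collinear P Q R = ∃ λ i → P ∈ line F i × Q ∈ line F i × R ∈ line F i

  collinear? : ∀ P Q R → Dec (Collinear P Q R)
  collinear? P Q R = any? λ i → (P ∈? line F i) ×-dec (Q ∈? line F i) ×-dec (R ∈? line F i)

  collinear-swap₁₂ : Collinear P Q R → Collinear Q P R
  collinear-swap₁₂ (i , P∈i , Q∈i , R∈i) = i , Q∈i , P∈i , R∈i

  collinear-swap₂₃ : Collinear P Q R → Collinear P R Q
  collinear-swap₂₃ (i , P∈i , Q∈i , R∈i) = i , P∈i , R∈i , Q∈i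

  line-unique : P ≢ Q → P ∈ line F i → Q ∈ line F i → P ∈ line F j → Q ∈ line F j → i ≡ j
  line-unique {P} {Q} P≢Q P∈i Q∈i P∈j Q∈j =
    let _ , _ , unique = two-points F P Q P≢Q in trans (sym (unique (P∈i , Q∈i))) (unique (P∈j , Q∈j))

  collinear⇒∈ : P ≢ Q → P ∈ line F i → Q ∈ line F i → Collinear P Q R → R ∈ line F i
  collinear⇒∈ {R = R} P≢Q P∈i Q∈i (j , P∈j , Q∈j , R∈j) =
    subst (λ k → R ∈ line F k) (line-unique P≢Q P∈j Q∈j P∈i Q∈i) R∈j

  collinear-exchange : P ≢ Q → Collinear P Q R → Collinear P Q S → Collinear P R S
  collinear-exchange P≢Q (i , P∈i , Q∈i , R∈i) PQS = i , P∈i , R∈i , collinear⇒∈ P≢Q P∈i Q∈i PQS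

  no-fourth-point : P ∈ line F i → Q ∈ line F i → R ∈ line F i → S ∈ line F i →
                    P ≢ Q → P ≢ R → P ≢ S → Q ≢ R → Q ≢ S → R ≢ S → ⊥
  no-fourth-point {i = i} P∈i Q∈i R∈i S∈i P≢Q P≢R P≢S Q≢R Q≢S R≢S
    with s≤s (s≤s (s≤s ())) ← subst (4 ≤_) (line-size F i)
           (four-members⇒4≤∣p∣ P∈i Q∈i R∈i S∈i P≢Q P≢R P≢S Q≢R Q≢S R≢S)

  another-point : (P : Fin 7) → ∃ λ Q → P ≢ Q
  another-point 0F = 1F , λ ()
  another-point (suc _) = 0F , λ ()

  joining-line : (P Q : Fin 7) → ∃ λ i → P ∈ line F i × Q ∈ line F i
  joining-line P Q with P ≟ Q
  ... | no P≢Q = let i , (P∈i , Q∈i) , _ = two-points F P Q P≢Q in i , P∈i , Q∈i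
  ... | yes refl = let Q , P≢Q = another-point P
                       i , (P∈i , _) , _ = two-points F P Q P≢Q
                   in i , P∈i , P∈i

  IsThird : Fin 7 → Fin 7 → Fin 7 → Set
  IsThird P Q R = R ≢ P × R ≢ Q × Collinear P Q R

  isThird? : ∀ P Q R → Dec (IsThird P Q R)
  isThird? P Q R = ¬? (R ≟ P) ×-dec ¬? (R ≟ Q) ×-dec collinear? P Q R

  third-exists : P ≢ Q → ∃ (IsThird P Q)
  third-exists {P} {Q} P≢Q =
    let i , (P∈i , Q∈i) , _ = two-points F P Q P≢Q
        R , R∈i , R≢P , R≢Q = third-member (≤-reflexive (sym (line-size F i))) P Q
    in R , R≢P , R≢Q , i , P∈i , Q∈i , R∈i

  third-point : Dec (∃ (IsThird P Q)) → Fin 7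
  third-point (yes (R , _)) = R
  third-point {P} (no _) = P

  -- For P ≡ Q the value of P ⊞ Q is junk.
  infixl 6 _⊞_
  opaque
    _⊞_ : Fin 7 → Fin 7 → Fin 7
    P ⊞ Q = third-point (any? (isThird? P Q))

    ⊞-isThird : P ≢ Q → IsThird P Q (P ⊞ Q)
    ⊞-isThird {P} {Q} P≢Q = spec (any? (isThird? P Q))
      where
      spec : (d : Dec (∃ (IsThird P Q))) → IsThird P Q (third-point d)
      spec (yes (_ , R-third)) = R-third
      spec (no none) = contradiction (third-exists P≢Q) none

  ⊞-unique : P ≢ Q → IsThird P Q R → R ≡ P ⊞ Q
  ⊞-unique {P} {Q} {R} P≢Q (R≢P , R≢Q , i , P∈i , Q∈i , R∈i) with R ≟ P ⊞ Q
  ... | yes R≡P⊞Q = R≡P⊞Q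
  ... | no R≢P⊞Q =
    let S≢P , S≢Q , PQS = ⊞-isThird P≢Q
    in ⊥-elim (no-fourth-point P∈i Q∈i R∈i (collinear⇒∈ P≢Q P∈i Q∈i PQS)
                 P≢Q (≢-sym R≢P) (≢-sym S≢P) (≢-sym R≢Q) (≢-sym S≢Q) R≢P⊞Q)

  ⊞-comm : ∀ P Q → P ⊞ Q ≡ Q ⊞ P
  ⊞-comm P Q with P ≟ Q
  ... | yes refl = refl
  ... | no P≢Q = let S≢P , S≢Q , PQS = ⊞-isThird P≢Q
                 in ⊞-unique (≢-sym P≢Q) (S≢Q , S≢P , collinear-swap₁₂ PQS)

  ⊞-cancel : P ≢ Q → P ⊞ (P ⊞ Q) ≡ Q
  ⊞-cancel P≢Q = let S≢P , S≢Q , PQS = ⊞-isThird P≢Q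
                 in sym (⊞-unique (≢-sym S≢P) (≢-sym P≢Q , ≢-sym S≢Q , collinear-swap₂₃ PQS))

  ⊞-dual : ∀ {φ} → IsDual F φ → P ≢ Q → φ (P ⊞ Q) ≡ φ P xor φ Q
  ⊞-dual {P} {Q} φ-dual P≢Q =
    let S≢P , S≢Q , i , P∈i , Q∈i , S∈i = ⊞-isThird P≢Q
    in φ-dual i P Q (P ⊞ Q) P∈i Q∈i S∈i P≢Q (≢-sym S≢Q) (≢-sym S≢P)

  Triangle : Fin 7 → Fin 7 → Fin 7 → Set
  Triangle P Q R = ¬ Collinear P Q R

  triangle-swap₁₂ : Triangle P Q R → Triangle Q P R
  triangle-swap₁₂ PQR QPR = PQR (collinear-swap₁₂ QPR)

  triangle-swap₂₃ : Triangle P Q R → Triangle P R Q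
  triangle-swap₂₃ PQR PRQ = PQR (collinear-swap₂₃ PRQ)

  triangle⇒≢ : Triangle P Q R → P ≢ Q
  triangle⇒≢ {P} {R = R} PQR refl = let i , P∈i , R∈i = joining-line P R in PQR (i , P∈i , P∈i , R∈i)

  triangle⇒≢⊞ : Triangle P Q R → R ≢ P ⊞ Q
  triangle⇒≢⊞ PQR refl = PQR (proj₂ (proj₂ (⊞-isThird (triangle⇒≢ PQR))))

  triangle-⊞ : Triangle P Q R → Triangle P (P ⊞ Q) R
  triangle-⊞ PQR PSR =
    let P≢Q = triangle⇒≢ PQR
        S≢P , _ , PQS = ⊞-isThird P≢Q
    in PQR (collinear-exchange (≢-sym S≢P) (collinear-swap₂₃ PQS) PSR)

  triangle-rotate : Triangle P Q R → Triangle Q R P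
  triangle-rotate PQR = triangle-swap₂₃ (triangle-swap₁₂ PQR)

  triangle-reverse : Triangle P Q R → Triangle R Q P
  triangle-reverse PQR = triangle-swap₁₂ (triangle-rotate PQR)

  triangle-⊞-⊞ : Triangle P Q R → Triangle P (P ⊞ Q) (Q ⊞ R)
  triangle-⊞-⊞ PQR = triangle-⊞ (triangle-swap₁₂ (triangle-swap₂₃ (triangle-⊞ (triangle-rotate PQR))))

  triangle-⊞ʳ : Triangle P Q R → Triangle P (Q ⊞ R) R
  triangle-⊞ʳ {P} {Q} {R} PQR =
    let RTP = subst (λ T → Triangle R T P) (⊞-comm R Q) (triangle-⊞ (triangle-reverse PQR))
    in triangle-swap₁₂ (triangle-swap₂₃ (triangle-swap₁₂ RTP))

  meet : Triangle P Q R → ∃ λ Y → Collinear P (Q ⊞ R) Y × Collinear (P ⊞ Q) R Y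
  meet {P} {Q} {R} PQR with joining-line P (Q ⊞ R) | joining-line (P ⊞ Q) R
  ... | i , P∈i , T∈i | j , S∈j , R∈j =
    let Y , (Y∈i , Y∈j) , _ = two-lines F i j i≢j
    in Y , (i , P∈i , T∈i , Y∈i) , (j , S∈j , R∈j , Y∈j)
    where
    i≢j : i ≢ j
    i≢j refl = triangle-⊞ PQR (i , P∈i , S∈j , R∈j)

  meet-is-third : Triangle P Q R → Collinear P (Q ⊞ R) Y → Collinear (P ⊞ Q) R Y → Y ≡ P ⊞ Q ⊞ R
  meet-is-third {P} {Q} {R} {Y} PQR PTY SRY =
    ⊞-unique (triangle⇒≢ (triangle-swap₂₃ (triangle-swap₁₂ (triangle-⊞ PQR)))) (Y≢S , Y≢R , SRY)
    where
    Y≢S : Y ≢ P ⊞ Q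
    Y≢S refl = triangle-⊞-⊞ PQR (collinear-swap₂₃ PTY)
    Y≢R : Y ≢ R
    Y≢R refl = triangle-⊞ʳ PQR PTY

  ⊞-assoc : Triangle P Q R → P ⊞ Q ⊞ R ≡ P ⊞ (Q ⊞ R)
  ⊞-assoc {P} {Q} {R} PQR =
    let Y , PTY , SRY = meet PQR
        RSY = subst (λ S → Collinear R S Y) (⊞-comm P Q) (collinear-swap₁₂ SRY)
        TPY = subst (λ T → Collinear T P Y) (⊞-comm Q R) (collinear-swap₁₂ PTY)
    in begin
      P ⊞ Q ⊞ R   ≡⟨ sym (meet-is-third PQR PTY SRY) ⟩
      Y           ≡⟨ meet-is-third (triangle-reverse PQR) RSY TPY ⟩
      R ⊞ Q ⊞ P   ≡⟨ ⊞-comm (R ⊞ Q) P ⟩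
      P ⊞ (R ⊞ Q) ≡⟨ cong (P ⊞_) (⊞-comm R Q) ⟩
      P ⊞ (Q ⊞ R) ∎
    where open ≡-Reasoning

all?ᴮ : {P : Bool → Set} → Decidable P → Dec (∀ b → P b)
all?ᴮ P? with P? false | P? true
... | yes p | yes q = yes λ { false → p ; true → q }
... | no ¬p | _     = no λ all → ¬p (all false)
... | yes _ | no ¬q = no λ all → ¬q (all true)

Vec𝔽₂³ : Set
Vec𝔽₂³ = Bool × Bool × Bool

-- Point k of the standard Fano plane is the nonzero vector of 𝔽₂³ whose binary
-- expansion (lowest bit first) is k + 1; so 0F, 1F, 3F are the unit vectors.
lin : Bool → Bool → Bool → Fin 7 → Bool
lin u v w 0F = u
lin u v w 1F = v
lin u v w 2F = u xor v
lin u v w 3F = w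
lin u v w 4F = u xor w
lin u v w 5F = v xor w
lin u v w 6F = (u xor v) xor w

toVector : Fin 7 → Vec𝔽₂³
toVector p = lin true false false p , lin false true false p , lin false false true p

fromVector : Vec𝔽₂³ → Fin 7
fromVector (true  , false , false) = 0F
fromVector (false , true  , false) = 1F
fromVector (true  , true  , false) = 2F
fromVector (false , false , true ) = 3F
fromVector (true  , false , true ) = 4F
fromVector (false , true  , true ) = 5F
fromVector (true  , true  , true ) = 6F
fromVector (false , false , false) = 0F   -- junk: the zero vector is not a point

infixl 6 _+ₛ_
_+ₛ_ : Fin 7 → Fin 7 → Fin 7
p +ₛ q with toVector p | toVector q
... | x , y , z | x′ , y′ , z′ = fromVector (x xor x′ , y xor y′ , z xor z′)

+ₛ-≢ : ∀ p q → p ≢ q → p +ₛ q ≢ p × p +ₛ q ≢ q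
+ₛ-≢ = toWitness {a? = all? λ p → all? λ q → ¬? (p ≟ q) →-dec (¬? (p +ₛ q ≟ p) ×-dec ¬? (p +ₛ q ≟ q))} _

StdDual : (Fin 7 → Bool) → Set
StdDual g = ∀ p q → p ≢ q → g (p +ₛ q) ≡ g p xor g q

stdDual? : ∀ g → Dec (StdDual g)
stdDual? g = all? λ p → all? λ q → ¬? (p ≟ q) →-dec (g (p +ₛ q) ≟ᴮ (g p xor g q))

lin-stdDual : ∀ u v w → StdDual (lin u v w)
lin-stdDual = toWitness {a? = all?ᴮ λ u → all?ᴮ λ v → all?ᴮ λ w → stdDual? (lin u v w)} _

stdDual⇒lin : ∀ {g} → StdDual g → ∀ p → g p ≡ lin (g 0F) (g 1F) (g 3F) p
stdDual⇒lin g-dual 0F = refl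
stdDual⇒lin g-dual 1F = refl
stdDual⇒lin g-dual 2F = g-dual 0F 1F λ ()
stdDual⇒lin g-dual 3F = refl
stdDual⇒lin g-dual 4F = g-dual 0F 3F λ ()
stdDual⇒lin g-dual 5F = g-dual 1F 3F λ ()
stdDual⇒lin {g} g-dual 6F = trans (g-dual 2F 3F λ ()) (cong (_xor g 3F) (g-dual 0F 1F λ ()))

lin-cong : ∀ {u u′ v v′ w w′} → u ≡ u′ → v ≡ v′ → w ≡ w′ → ∀ p → lin u v w p ≡ lin u′ v′ w′ p
lin-cong refl refl refl p = refl

-- The alternating form whose Gram matrix on the unit vectors is [[0,x,y],[x,0,z],[y,z,0]].
alt : Vec𝔽₂³ → Fin 7 → Fin 7 → Bool
alt (x , y , z) p = lin (lin false x y p) (lin x false z p) (lin y z false p)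

alt-stdDual : ∀ c p → StdDual (alt c p)
alt-stdDual (x , y , z) p = lin-stdDual _ _ _

alt-symmetric : ∀ c p q → alt c p q ≡ alt c q p
alt-symmetric (x , y , z) = toWitness {a? = all?ᴮ λ x → all?ᴮ λ y → all?ᴮ λ z →
  all? λ p → all? λ q → alt (x , y , z) p q ≟ᴮ alt (x , y , z) q p} _ x y z

alt-diagonal : ∀ c p → alt c p p ≡ false
alt-diagonal (x , y , z) = toWitness {a? = all?ᴮ λ x → all?ᴮ λ y → all?ᴮ λ z →
  all? λ p → alt (x , y , z) p p ≟ᴮ false} _ x y z

alt-injective : ∀ {c c′} → (∀ p q → alt c p q ≡ alt c′ p q) → c ≡ c′
alt-injective {x , y , z} {x′ , y′ , z′} same = cong₂ _,_ (same 0F 1F) (cong₂ _,_ (same 0F 3F) (same 1F 3F))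

alternating-classification : ∀ {B : Fin 7 → Fin 7 → Bool} → (∀ p → StdDual (B p)) →
  (∀ p q → B p q ≡ B q p) → (∀ p → B p p ≡ false) →
  ∀ p q → B p q ≡ alt (B 0F 1F , B 0F 3F , B 1F 3F) p q
alternating-classification {B} rows-dual B-sym B-diag p q = begin
  B p q                                 ≡⟨ stdDual⇒lin (rows-dual p) q ⟩
  lin (B p 0F) (B p 1F) (B p 3F) q      ≡⟨ lin-cong (column 0F) (column 1F) (column 3F) q ⟩
  lin (lin (B 0F 0F) (B 0F 1F) (B 0F 3F) p)
      (lin (B 1F 0F) (B 1F 1F) (B 1F 3F) p)
      (lin (B 3F 0F) (B 3F 1F) (B 3F 3F) p) q
    ≡⟨ lin-cong (lin-cong (B-diag 0F) refl refl p)
                (lin-cong (B-sym 1F 0F) (B-diag 1F) refl p)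
                (lin-cong (B-sym 3F 0F) (B-sym 3F 1F) (B-diag 3F) p) q ⟩
  alt (B 0F 1F , B 0F 3F , B 1F 3F) p q ∎
  where
  open ≡-Reasoning
  column : ∀ e → B p e ≡ lin (B e 0F) (B e 1F) (B e 3F) p
  column e = trans (B-sym p e) (stdDual⇒lin (rows-dual e) p)

-- A 0-oriented map of the standard plane, found by exhaustive search.
stdOriented₀ : Fin 7 → Fin 7 → Bool
stdOriented₀ 0F = lin true  false false
stdOriented₀ 1F = lin true  true  false
stdOriented₀ 2F = lin false true  true
stdOriented₀ 3F = lin true  true  true
stdOriented₀ 4F = lin false false true
stdOriented₀ 5F = lin true  false true
stdOriented₀ 6F = lin false true  false

stdOriented₀-stdDual : ∀ p → StdDual (stdOriented₀ p)
stdOriented₀-stdDual p = toWitness {a? = all? λ p → stdDual? (stdOriented₀ p)} _ p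

stdOriented₀-diagonal : ∀ p → stdOriented₀ p p ≡ true
stdOriented₀-diagonal = toWitness {a? = all? λ p → stdOriented₀ p p ≟ᴮ true} _

stdOriented₀-antisymmetric : ∀ p q → p ≢ q → stdOriented₀ p q xor stdOriented₀ q p ≡ true
stdOriented₀-antisymmetric = toWitness {a? = all? λ p → all? λ q → ¬? (p ≟ q) →-dec (stdOriented₀ p q xor stdOriented₀ q p ≟ᴮ true)} _

cube : Fin 8 → Vec𝔽₂³
cube 0F = false , false , false
cube 1F = true  , false , false
cube 2F = false , true  , false
cube 3F = true  , true  , false
cube 4F = false , false , true
cube 5F = true  , false , true
cube 6F = false , true  , true
cube 7F = true  , true  , true

cube-injective : ∀ k l → cube k ≡ cube l → k ≡ l
cube-injective = toWitness {a? = all? λ k → all? λ l → (cube k ≟³ cube l) →-dec (k ≟ l)} _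
  where
  _≟³_ : (c c′ : Vec𝔽₂³) → Dec (c ≡ c′)
  _≟³_ = ≡-dec _≟ᴮ_ (≡-dec _≟ᴮ_ _≟ᴮ_)

cube-surjective : ∀ c → ∃ λ k → cube k ≡ c
cube-surjective (false , false , false) = 0F , refl
cube-surjective (true  , false , false) = 1F , refl
cube-surjective (false , true  , false) = 2F , refl
cube-surjective (true  , true  , false) = 3F , refl
cube-surjective (false , false , true ) = 4F , refl
cube-surjective (true  , false , true ) = 5F , refl
cube-surjective (false , true  , true ) = 6F , refl
cube-surjective (true  , true  , true ) = 7F , refl

span : Fin 7 → Fin 7 × Fin 7
span 0F = 0F , 1F
span 1F = 0F , 3F
span 2F = 1F , 3F
span 3F = 2F , 3F
span 4F = 0F , 5F
span 5F = 1F , 4F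
span 6F = 2F , 4F

span₁ span₂ : Fin 7 → Fin 7
span₁ t = proj₁ (span t)
span₂ t = proj₂ (span t)

data OnLine (t : Fin 7) : Fin 7 → Set where
  first  : OnLine t (span₁ t)
  second : OnLine t (span₂ t)
  third  : OnLine t (span₁ t +ₛ span₂ t)

onLine? : ∀ t x → Dec (OnLine t x)
onLine? t x with x ≟ span₁ t | x ≟ span₂ t | x ≟ span₁ t +ₛ span₂ t
... | yes refl | _        | _        = yes first
... | no _     | yes refl | _        = yes second
... | no _     | no _     | yes refl = yes third
... | no x≢₁   | no x≢₂   | no x≢₃   = no λ { first → x≢₁ refl ; second → x≢₂ refl ; third → x≢₃ refl }

spanning-line : ∀ p q → p ≢ q → ∃ λ t → OnLine t p × OnLine t q × OnLine t (p +ₛ q)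
spanning-line = toWitness {a? = all? λ p → all? λ q → ¬? (p ≟ q) →-dec
  any? λ t → onLine? t p ×-dec onLine? t q ×-dec onLine? t (p +ₛ q)} _

module Coordinates (F : FanoPlane) where
  open Geometry F

  third-vertex : ∃ (Triangle 0F 1F)
  third-vertex with any? (λ d → ¬? (collinear? 0F 1F d)) | joining-line 0F 1F
  ... | yes found | _ = found
  ... | no none | i , 0∈i , 1∈i =
    ⊥-elim (no-fourth-point 0∈i 1∈i (on-i 2F) (on-i 3F) (λ ()) (λ ()) (λ ()) (λ ()) (λ ()) (λ ()))
    where
    on-i : ∀ x → x ∈ line F i
    on-i x = collinear⇒∈ (λ ()) 0∈i 1∈i (decidable-stable (collinear? 0F 1F x) λ ¬col → none (x , ¬col))

  a b d : Fin 7
  a = 0F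
  b = 1F
  d = proj₁ third-vertex

  abd : Triangle a b d
  abd = proj₂ third-vertex

  ι : Fin 7 → Fin 7
  ι 0F = a
  ι 1F = b
  ι 2F = a ⊞ b
  ι 3F = d
  ι 4F = a ⊞ d
  ι 5F = b ⊞ d
  ι 6F = a ⊞ b ⊞ d

  ι-span : ∀ t → ι (span₁ t +ₛ span₂ t) ≡ ι (span₁ t) ⊞ ι (span₂ t)
  ι-span 0F = refl
  ι-span 1F = refl
  ι-span 2F = refl
  ι-span 3F = refl
  ι-span 4F = ⊞-assoc abd
  ι-span 5F = trans (cong (_⊞ d) (⊞-comm a b)) (⊞-assoc (triangle-swap₁₂ abd))
  ι-span 6F = begin
    b ⊞ d             ≡⟨ cong (_⊞ d) b≡c⊞a ⟩
    a ⊞ b ⊞ a ⊞ d     ≡⟨ ⊞-assoc (triangle-swap₁₂ (triangle-⊞ abd)) ⟩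
    a ⊞ b ⊞ (a ⊞ d)   ∎
    where
    open ≡-Reasoning
    b≡c⊞a : b ≡ a ⊞ b ⊞ a
    b≡c⊞a = trans (sym (⊞-cancel (triangle⇒≢ abd))) (⊞-comm a (a ⊞ b))

  ι-span-≢ : ∀ t → ι (span₁ t) ≢ ι (span₂ t)
  ι-span-≢ 0F = triangle⇒≢ abd
  ι-span-≢ 1F = triangle⇒≢ (triangle-swap₂₃ abd)
  ι-span-≢ 2F = triangle⇒≢ (triangle-rotate abd)
  ι-span-≢ 3F = triangle⇒≢ (triangle-rotate (triangle-⊞ abd))
  ι-span-≢ 4F = triangle⇒≢⊞ (triangle-rotate abd)
  ι-span-≢ 5F = triangle⇒≢⊞ (triangle-swap₂₃ abd)
  ι-span-≢ 6F = triangle⇒≢⊞ (triangle-swap₂₃ (triangle-⊞ abd))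

  ι-line : ∀ t → ∃ λ i → ∀ {x} → OnLine t x → ι x ∈ line F i
  ι-line t =
    let _ , _ , i , P∈i , Q∈i , S∈i = ⊞-isThird (ι-span-≢ t)
    in i , λ { first → P∈i ; second → Q∈i ; third → subst (_∈ line F i) (sym (ι-span t)) S∈i }

  ι-line-≢ : ∀ t {x y} → OnLine t x → OnLine t y → x ≢ y → ι x ≢ ι y
  ι-line-≢ t x∈t y∈t x≢y with ⊞-isThird (ι-span-≢ t) | ι-span t
  ... | S≢P , S≢Q , _ | ιr≡S = go x∈t y∈t x≢y
    where
    go : ∀ {x y} → OnLine t x → OnLine t y → x ≢ y → ι x ≢ ι y
    go first  first  x≢y = contradiction refl x≢y
    go first  second _   = ι-span-≢ t
    go first  third  _   = λ eq → S≢P (trans (sym ιr≡S) (sym eq))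
    go second first  _   = ≢-sym (ι-span-≢ t)
    go second second x≢y = contradiction refl x≢y
    go second third  _   = λ eq → S≢Q (trans (sym ιr≡S) (sym eq))
    go third  first  _   = λ eq → S≢P (trans (sym ιr≡S) eq)
    go third  second _   = λ eq → S≢Q (trans (sym ιr≡S) eq)
    go third  third  x≢y = contradiction refl x≢y

  ι-≢ : ∀ {p q} → p ≢ q → ι p ≢ ι q
  ι-≢ {p} {q} p≢q = let t , p∈t , q∈t , _ = spanning-line p q p≢q in ι-line-≢ t p∈t q∈t p≢q

  ι-injective : Injective _≡_ _≡_ ι
  ι-injective {p} {q} ιp≡ιq with p ≟ q
  ... | yes p≡q = p≡q
  ... | no p≢q = contradiction ιp≡ιq (ι-≢ p≢q)

  ι-+ : ∀ {p q} → p ≢ q → ι (p +ₛ q) ≡ ι p ⊞ ι q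
  ι-+ {p} {q} p≢q =
    let t , p∈t , q∈t , r∈t = spanning-line p q p≢q
        i , on-i = ι-line t
        r≢p , r≢q = +ₛ-≢ p q p≢q
    in ⊞-unique (ι-≢ p≢q) (ι-≢ r≢p , ι-≢ r≢q , i , on-i p∈t , on-i q∈t , on-i r∈t)

  ι⁻¹ : Fin 7 → Fin 7
  ι⁻¹ P = proj₁ (injective⇒surjective ι ι-injective P)

  ι∘ι⁻¹ : ∀ P → ι (ι⁻¹ P) ≡ P
  ι∘ι⁻¹ P = proj₂ (injective⇒surjective ι ι-injective P)

  ι⁻¹∘ι : ∀ p → ι⁻¹ (ι p) ≡ p
  ι⁻¹∘ι p = ι-injective (ι∘ι⁻¹ (ι p))

  ι⁻¹-≢ : ∀ {P Q} → P ≢ Q → ι⁻¹ P ≢ ι⁻¹ Q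
  ι⁻¹-≢ {P} {Q} P≢Q eq = P≢Q (trans (sym (ι∘ι⁻¹ P)) (trans (cong ι eq) (ι∘ι⁻¹ Q)))

  dual-pullback : ∀ {φ} → IsDual F φ → StdDual (λ p → φ (ι p))
  dual-pullback {φ} φ-dual p q p≢q = trans (cong φ (ι-+ p≢q)) (⊞-dual φ-dual (ι-≢ p≢q))

  dual-pushforward : ∀ {γ} → StdDual γ → IsDual F (λ P → γ (ι⁻¹ P))
  dual-pushforward {γ} γ-dual i P Q R P∈i Q∈i R∈i P≢Q Q≢R P≢R = begin
    γ (ι⁻¹ R)           ≡⟨ cong (λ S → γ (ι⁻¹ S)) R≡ι[p+q] ⟩
    γ (ι⁻¹ (ι (p +ₛ q))) ≡⟨ cong γ (ι⁻¹∘ι (p +ₛ q)) ⟩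
    γ (p +ₛ q)           ≡⟨ γ-dual p q (ι⁻¹-≢ P≢Q) ⟩
    γ p xor γ q          ∎
    where
    open ≡-Reasoning
    p = ι⁻¹ P
    q = ι⁻¹ Q
    R≡ι[p+q] : R ≡ ι (p +ₛ q)
    R≡ι[p+q] = begin
      R         ≡⟨ ⊞-unique P≢Q (≢-sym P≢R , Q≢R ∘ sym , i , P∈i , Q∈i , R∈i) ⟩
      P ⊞ Q     ≡⟨ sym (cong₂ _⊞_ (ι∘ι⁻¹ P) (ι∘ι⁻¹ Q)) ⟩
      ι p ⊞ ι q ≡⟨ sym (ι-+ (ι⁻¹-≢ P≢Q)) ⟩
      ι (p +ₛ q) ∎

  form : Vec𝔽₂³ → BForm
  form c P Q = alt c (ι⁻¹ P) (ι⁻¹ Q)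

  form-isS20 : ∀ c → IsS20 F (form c)
  form-isS20 c = (λ P → dual-pushforward {alt c (ι⁻¹ P)} (alt-stdDual c (ι⁻¹ P)))
               , (λ P Q → alt-symmetric c (ι⁻¹ P) (ι⁻¹ Q))
               , (λ P → alt-diagonal c (ι⁻¹ P))

  form-injective : ∀ {c c′} → form c ≗₂ form c′ → c ≡ c′
  form-injective {c} {c′} same = alt-injective λ p q →
    subst₂ (λ x y → alt c x y ≡ alt c′ x y) (ι⁻¹∘ι p) (ι⁻¹∘ι q) (same (ι p) (ι q))

  isS20⇒form : ∀ {Δ} → IsS20 F Δ → ∃ λ c → Δ ≗₂ form c
  isS20⇒form {Δ} (Δ-dual , Δ-sym , Δ-diag) = _ , λ P Q → trans
    (cong₂ Δ (sym (ι∘ι⁻¹ P)) (sym (ι∘ι⁻¹ Q)))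
    (alternating-classification {B = λ p q → Δ (ι p) (ι q)}
      (λ p → dual-pullback (Δ-dual (ι p))) (λ p q → Δ-sym (ι p) (ι q)) (λ p → Δ-diag (ι p))
      (ι⁻¹ P) (ι⁻¹ Q))

  oriented₀ : OMap
  oriented₀ P Q = stdOriented₀ (ι⁻¹ P) (ι⁻¹ Q)

  oriented₀-isOriented : IsOriented F zeroDual oriented₀
  oriented₀-isOriented = (λ P → dual-pushforward {stdOriented₀ (ι⁻¹ P)} (stdOriented₀-stdDual (ι⁻¹ P)))
                      , (λ P → trans (xor-identityʳ _) (stdOriented₀-diagonal (ι⁻¹ P)))
                      , (λ P Q P≢Q → stdOriented₀-antisymmetric (ι⁻¹ P) (ι⁻¹ Q) (ι⁻¹-≢ P≢Q))

corollary3p8 : (F : FanoPlane) →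
    ((n : PtFun) → IsDual F n →
      ((α : OMap) → IsOriented F n α → (Δ : BForm) → IsS20 F Δ →
         IsOriented F n (α ⊕ Δ))
      × ((α β : OMap) → IsOriented F n α → IsOriented F n β →
         Σ BForm (λ Δ → IsS20 F Δ × (β ≗₂ (α ⊕ Δ))
           × ((Δ′ : BForm) → IsS20 F Δ′ → β ≗₂ (α ⊕ Δ′) → Δ ≗₂ Δ′))))
    × Σ (Fin 8 → OMap) (λ e →
        ((k : Fin 8) → IsOriented F zeroDual (e k))
        × ((k l : Fin 8) → e k ≗₂ e l → k ≡ l)
        × ((α : OMap) → IsOriented F zeroDual α → ∃ (λ k → α ≗₂ e k)))
corollary3p8 F =
  (λ _ _ → (λ _ α-oriented _ Δ-S20 → ⊕-isOriented F α-oriented Δ-S20)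
         , λ α β α-oriented β-oriented →
             α ⊖ β , ⊖-isS20 F α-oriented β-oriented , ⊕-⊖ α β , λ _ _ → ⊖-unique {α})
  , element , element-isOriented , element-injective , element-exhaustive
  where
  open Coordinates F

  element : Fin 8 → OMap
  element k = oriented₀ ⊕ form (cube k)

  element-isOriented : ∀ k → IsOriented F zeroDual (element k)
  element-isOriented k = ⊕-isOriented F oriented₀-isOriented (form-isS20 (cube k))

  element-injective : ∀ k l → element k ≗₂ element l → k ≡ l
  element-injective k l same = cube-injective k l (form-injective (⊕-injectiveʳ {oriented₀} same))

  element-exhaustive : ∀ α → IsOriented F zeroDual α → ∃ λ k → α ≗₂ element k
  element-exhaustive α α-oriented =
    let c , α⊖≗form = isS20⇒form {oriented₀ ⊖ α} (⊖-isS20 F oriented₀-isOriented α-oriented)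
        k , cube-k≡c = cube-surjective c
    in k , λ P Q → trans (⊕-⊖ oriented₀ α P Q)
                         (cong (oriented₀ P Q xor_) (trans (α⊖≗form P Q) (cong (λ c → form c P Q) (sym cube-k≡c))))
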